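{- Let $T$ be a first-order $\mathscr L$-theory, $\mathcal W=Mod(T_W)$, and let $A$ be an object of $\mathcal W$ that is geometrically closed in $\mathcal W$. Then the affine coordinate algebra functor $\mathbf A:V\mapsto A[V]$, $f\mapsto A[f]$, is a duality (contravariant equivalence) between the category $Aff_A$ of affine algebraic varieties over $A$ and the category $\mathcal W_A^{fin}$ of finitely presented reduced $A$-algebras.
   Context: $T_W$ is the set of quasi-algebraic sentences ($\forall\bar y\,[\bigwedge\Phi\Rightarrow\psi]$, $\Phi\cup\{\psi\}$ a finite set of atomic formulas) implied by $T$. A homomorphism preserves atomic sentences with parameters; $f:A\to B$ is geometrically closed if it preserves every quasi-algebraic sentence with parameters in $A$ true in $A$, and $A$ is geometrically closed in $\mathcal W$ if every homomorphism from $A$ into a member of $\mathcal W$ is geometrically closed. $Th_W(A|A)$ is the set of quasi-algebraic $\mathscr L(A)$-sentences true in $A$. For a finite tuple $\bar x$, $A[\bar x]$ is the free $A$-algebra on $\bar x$ (the term algebra of $\mathscr L\cup A\cup\bar x$ modulo consequences of the atomic diagram of $A$). A reduced $A$-algebra is a homomorphism $A\to B$ with $B\in\mathcal W$; morphisms of $A$-algebras $f\to g$ are homomorphisms $h$ with $h\circ f=g$. A reduced $A$-algebra is finitely presented if it is presented in $\mathcal W$ by $(X,P\cup D^+A)$ with $X$ a finite set of new constants and $P$ a finite set of atomic $\mathscr L(A\cup X)$-sentences, i.e. it is an initial object among $\mathscr L(A\cup X)$-structures with $\mathscr L$-reduct in $\mathcal W$ satisfying $P\cup D^+A$. An affine variety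 over $A$ is a set $V=\pi(A)=\{\bar a\in A^n:A\models\bigwedge\pi(\bar a)\}$ for a finite set $\pi$ of atomic formulas in $x_1,\dots,x_n$ with parameters in $A$. For $V=\pi_1(A)\subseteq A^n$, $W=\pi_2(A)\subseteq A^m$, a morphism $f:V\to W$ is a map for which there is a conjunction $\phi(\bar x,\bar y)$ of atomic $\mathscr L(A)$-formulas such that: $Th_W(A|A)\models\forall\bar x\bar y\bar y'[\phi(\bar x,\bar y)\wedge\phi(\bar x,\bar y')\Rightarrow\bar y=\bar y']$; $Th_W(A|A)\models\forall\bar x[\bigwedge\pi_1(\bar x)\iff\exists\bar y\,\phi(\bar x,\bar y)]$; $Th_W(A|A)\cup\{\phi(\bar x,\bar y)\}\models\pi_2(\bar y)$; and $f(\bar b)=\bar c\iff A\models\phi(\bar b,\bar c)$ for $(\bar b,\bar c)\in V\times W$. These form the category $Aff_A$ (composition of maps). Every morphism $f$ agrees on $V$ with a tuple of $\mathscr L(A)$-terms $\bar t(\bar x)$. The coordinate algebra $A[V]$ is the quotient of $A[\bar x]$ by the $a$-type $tp_a^A(V)$ of atomic formulas with parameters in $A$ true at all points of $V$, with its natural $A$-algebra structure (it is reduced); for $f:V\to W$ given by terms $\bar t$, $A[f]:A[W]\to A[V]$ is the unique $A$-algebra morphism sending $y_j$ to $t_j(\bar x)$. -}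

module Defs where

open import Level using () renaming (suc to lsuc)
open import Data.Nat using (ℕ; suc)
open import Data.Fin using (Fin; zero; suc)
open import Data.Empty using (⊥)
open import Data.Sum using (_⊎_; inj₁; inj₂; [_,_])
open import Data.Product using (Σ; Σ-syntax; _×_; _,_; proj₁; proj₂)
open import Data.List using (List)
open import Data.List.Relation.Unary.All using (All)
open import Relation.Binary using (IsEquivalence)
open import Function using (id; _∘_)

record Signature : Set₁ where
  field
    Fun    : Set
    fArity : Fun → ℕ
    Rel    : Set
    rArity : Rel → ℕ

open Signature public

data Term (L : Signature) (X : Set) : Set where
  var : X → Term L X
  app : (f : Fun L) → (Fin (fArity L f) → Term L X) → Term L X

data Atom (L : Signature) (X : Set) : Set where
  _≐_  : Term L X → Term L X → Atom L X
  relA : (R : Rel L) → (Fin (rArity L R) → Term L X) → Atom L X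

data Formula (L : Signature) : ℕ → Set where
  atom   : ∀ {n} → Atom L (Fin n) → Formula L n
  falsum : ∀ {n} → Formula L n
  _∧'_   : ∀ {n} → Formula L n → Formula L n → Formula L n
  _∨'_   : ∀ {n} → Formula L n → Formula L n → Formula L n
  _⇒'_   : ∀ {n} → Formula L n → Formula L n → Formula L n
  all'   : ∀ {n} → Formula L (suc n) → Formula L n
  ex'    : ∀ {n} → Formula L (suc n) → Formula L n

Sentence : Signature → Set
Sentence L = Formula L 0

Theory : Signature → Set₁
Theory L = Sentence L → Set

-- Structures (carriers are setoids; the symbol = is interpreted by ≈)

record Structure (L : Signature) : Set₁ where
  field
    Carrier  : Set
    _≈_      : Carrier → Carrier → Set
    isEquiv  : IsEquivalence _≈_
    fun      : (f : Fun L) → (Fin (fArity L f) → Carrier) → Carrier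
    rel      : (R : Rel L) → (Fin (rArity L R) → Carrier) → Set
    fun-cong : ∀ f {u v} → (∀ i → u i ≈ v i) → fun f u ≈ fun f v
    rel-cong : ∀ R {u v} → (∀ i → u i ≈ v i) → rel R u → rel R v

open Structure public

module _ {L : Signature} where

  eval : (M : Structure L) {X : Set} → (X → Carrier M) → Term L X → Carrier M
  eval M ρ (var x)    = ρ x
  eval M ρ (app f ts) = fun M f (λ i → eval M ρ (ts i))

  SatAtom : (M : Structure L) {X : Set} → (X → Carrier M) → Atom L X → Set
  SatAtom M ρ (t ≐ s)    = _≈_ M (eval M ρ t) (eval M ρ s)
  SatAtom M ρ (relA R ts) = rel M R (λ i → eval M ρ (ts i))

  SatAll : (M : Structure L) {X : Set} → (X → Carrier M) → List (Atom L X) → Set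
  SatAll M ρ Φ = All (SatAtom M ρ) Φ

  extend : {M : Structure L} {n : ℕ} → Carrier M → (Fin n → Carrier M) → Fin (suc n) → Carrier M
  extend a ρ zero    = a
  extend a ρ (suc i) = ρ i

  Sat : (M : Structure L) {n : ℕ} → (Fin n → Carrier M) → Formula L n → Set
  Sat M ρ (atom α)  = SatAtom M ρ α
  Sat M ρ falsum    = ⊥
  Sat M ρ (φ ∧' ψ)  = Sat M ρ φ × Sat M ρ ψ
  Sat M ρ (φ ∨' ψ)  = Sat M ρ φ ⊎ Sat M ρ ψ
  Sat M ρ (φ ⇒' ψ)  = Sat M ρ φ → Sat M ρ ψ
  Sat M ρ (all' φ)  = (a : Carrier M) → Sat M (extend {M} a ρ) φ
  Sat M ρ (ex' φ)   = Σ (Carrier M) λ a → Sat M (extend {M} a ρ) φ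

  SatSentence : (M : Structure L) → Sentence L → Set
  SatSentence M φ = Sat M (λ ()) φ

  Models : Structure L → Theory L → Set
  Models M T = ∀ φ → T φ → SatSentence M φ

  -- Quasi-algebraic sentences  ∀ ȳ [ ⋀Φ ⇒ ψ ]  with parameters from P

  record QA (P : Set) : Set where
    field
      nvars : ℕ
      prem  : List (Atom L (P ⊎ Fin nvars))
      concl : Atom L (P ⊎ Fin nvars)

  SatQA : (M : Structure L) {P : Set} → (P → Carrier M) → QA P → Set
  SatQA M c σ = (y : Fin (QA.nvars σ) → Carrier M) →
                SatAll M [ c , y ] (QA.prem σ) → SatAtom M [ c , y ] (QA.concl σ)

  QASentence : Set
  QASentence = QA ⊥

  noParams : {M : Structure L} → ⊥ → Carrier M
  noParams ()

  T_W : Theory L → QASentence → Set₁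
  T_W T σ = (M : Structure L) → Models M T → SatQA M (noParams {M}) σ

  InW : Theory L → Structure L → Set₁
  InW T M = (σ : QASentence) → T_W T σ → SatQA M (noParams {M}) σ

  IsHom : (A B : Structure L) → (Carrier A → Carrier B) → Set
  IsHom A B h = (α : Atom L (Carrier A)) → SatAtom A id α → SatAtom B h α

  GeomClosedMap : (A B : Structure L) → (Carrier A → Carrier B) → Set
  GeomClosedMap A B h = (σ : QA (Carrier A)) → SatQA A id σ → SatQA B h σ

  GeomClosedIn : Theory L → Structure L → Set₁
  GeomClosedIn T A = (B : Structure L) → InW T B →
                     (h : Carrier A → Carrier B) → IsHom A B h → GeomClosedMap A B h

  module _ (T : Theory L) (A : Structure L) where

    -- Th_W(A|A) ⊨ ... : truth in every L(A)-structure (M , c) satisfying all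
    -- quasi-algebraic L(A)-sentences true in A
    ModelOfThWA : (M : Structure L) → (Carrier A → Carrier M) → Set
    ModelOfThWA M c = (σ : QA (Carrier A)) → SatQA A id σ → SatQA M c σ

    -- affine varieties over A, given by n and a finite set π of atomic formulas
    record AffVar : Set where
      field
        dim : ℕ
        eqs : List (Atom L (Carrier A ⊎ Fin dim))

    open AffVar public

    Point : AffVar → Set
    Point V = Σ[ x ∈ (Fin (dim V) → Carrier A) ] SatAll A [ id , x ] (eqs V)

    _≈ₚ_ : {V : AffVar} → Point V → Point V → Set
    p ≈ₚ q = ∀ i → _≈_ A (proj₁ p i) (proj₁ q i)

    record AffMor (V W : AffVar) : Set₁ where
      field
        map  : Point V → Point W
        φ    : List (Atom L (Carrier A ⊎ (Fin (dim V) ⊎ Fin (dim W))))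
        func : (M : Structure L) (c : Carrier A → Carrier M) → ModelOfThWA M c →
               (x : Fin (dim V) → Carrier M) (y y' : Fin (dim W) → Carrier M) →
               SatAll M [ c , [ x , y ] ] φ → SatAll M [ c , [ x , y' ] ] φ →
               ∀ j → _≈_ M (y j) (y' j)
        dom→ : (M : Structure L) (c : Carrier A → Carrier M) → ModelOfThWA M c →
               (x : Fin (dim V) → Carrier M) →
               SatAll M [ c , x ] (eqs V) →
               Σ[ y ∈ (Fin (dim W) → Carrier M) ] SatAll M [ c , [ x , y ] ] φ
        dom← : (M : Structure L) (c : Carrier A → Carrier M) → ModelOfThWA M c →
               (x : Fin (dim V) → Carrier M) →
               Σ[ y ∈ (Fin (dim W) → Carrier M) ] SatAll M [ c , [ x , y ] ] φ →
               SatAll M [ c , x ] (eqs V)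
        cod  : (M : Structure L) (c : Carrier A → Carrier M) → ModelOfThWA M c →
               (x : Fin (dim V) → Carrier M) (y : Fin (dim W) → Carrier M) →
               SatAll M [ c , [ x , y ] ] φ → SatAll M [ c , y ] (eqs W)
        graph→ : (b : Point V) (c : Point W) → map b ≈ₚ c →
                 SatAll A [ id , [ proj₁ b , proj₁ c ] ] φ
        graph← : (b : Point V) (c : Point W) →
                 SatAll A [ id , [ proj₁ b , proj₁ c ] ] φ → map b ≈ₚ c

    open AffMor public

    _≈Aff_ : {V W : AffVar} → AffMor V W → AffMor V W → Set
    f ≈Aff g = ∀ p → map f p ≈ₚ map g p

    record PreAlg : Set₁ where
      field
        Str : Structure L
        str : Carrier A → Carrier Str

    open PreAlg public

    IsReducedAlg : PreAlg → Set₁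
    IsReducedAlg B = InW T (Str B) × IsHom A (Str B) (str B)

    record AlgMor (B C : PreAlg) : Set where
      field
        hmap : Carrier (Str B) → Carrier (Str C)
        hom  : IsHom (Str B) (Str C) hmap
        comm : ∀ a → _≈_ (Str C) (hmap (str B a)) (str C a)

    open AlgMor public

    _≈Mor_ : {B C : PreAlg} → AlgMor B C → AlgMor B C → Set
    _≈Mor_ {C = C} h k = ∀ b → _≈_ (Str C) (hmap h b) (hmap k b)

    idMor : (B : PreAlg) → AlgMor B B → Set
    idMor B h = ∀ b → _≈_ (Str B) (hmap h b) b

    Iso : PreAlg → PreAlg → Set
    Iso B C = Σ[ h ∈ AlgMor B C ] Σ[ k ∈ AlgMor C B ]
                (∀ b → _≈_ (Str B) (hmap k (hmap h b)) b) ×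
                (∀ c → _≈_ (Str C) (hmap h (hmap k c)) c)

    -- finitely presented: presented in W by (X , P ∪ D⁺A), X finite, P finite,
    -- i.e. initial among L(A ∪ X)-structures with L-reduct in W satisfying P ∪ D⁺A
    IsFinPres : PreAlg → Set₁
    IsFinPres B =
      Σ[ k ∈ ℕ ] Σ[ P ∈ List (Atom L (Carrier A ⊎ Fin k)) ]
      Σ[ g ∈ (Fin k → Carrier (Str B)) ]
        InW T (Str B) ×
        IsHom A (Str B) (str B) ×
        SatAll (Str B) [ str B , g ] P ×
        ((C : Structure L) → InW T C →
         (c : Carrier A → Carrier C) (x : Fin k → Carrier C) →
         IsHom A C c → SatAll C [ c , x ] P →
         Σ[ h ∈ (Carrier (Str B) → Carrier C) ]
           (IsHom (Str B) C h ×
            (∀ a → _≈_ C (h (str B a)) (c a)) ×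
            (∀ i → _≈_ C (h (g i)) (x i)) ×
            ((h' : Carrier (Str B) → Carrier C) →
              IsHom (Str B) C h' →
              (∀ a → _≈_ C (h' (str B a)) (c a)) →
              (∀ i → _≈_ C (h' (g i)) (x i)) →
              ∀ b → _≈_ C (h b) (h' b))))

    IsFinPresReducedAlg : PreAlg → Set₁
    IsFinPresReducedAlg B = IsReducedAlg B × IsFinPres B

    -- The coordinate algebra A[V] = A[x̄] / tp_a^A(V): terms in x̄ with
    -- parameters in A, two terms identified (resp. a relation holding)
    -- iff this holds at every point of V.

    module _ (V : AffVar) where

      private
        Tm = Term L (Carrier A ⊎ Fin (dim V))
        ev : Point V → Tm → Carrier A
        ev p = eval A [ id , proj₁ p ]
        module EA = IsEquivalence (isEquiv A)

      coordStr : Structure L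
      coordStr = record
        { Carrier  = Tm
        ; _≈_      = λ t s → (p : Point V) → _≈_ A (ev p t) (ev p s)
        ; isEquiv  = record
            { refl  = λ p → EA.refl
            ; sym   = λ e p → EA.sym (e p)
            ; trans = λ e e' p → EA.trans (e p) (e' p) }
        ; fun      = app
        ; rel      = λ R ts → (p : Point V) → rel A R (λ i → ev p (ts i))
        ; fun-cong = λ f e p → fun-cong A f (λ i → e i p)
        ; rel-cong = λ R e r p → rel-cong A R (λ i → e i p) (r p)
        }

      coordAlg : PreAlg
      coordAlg = record { Str = coordStr ; str = λ a → var (inj₁ a) }

    -- the defining property of A[f] : A[W] → A[V] (sending y_j to a term
    -- agreeing with the j-th coordinate of f on V)
    IsCoordMor : {V W : AffVar} → AffMor V W → AlgMor (coordAlg W) (coordAlg V) → Set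
    IsCoordMor {V} {W} f h =
      (u : Term L (Carrier A ⊎ Fin (dim W))) (p : Point V) →
      _≈_ A (eval A [ id , proj₁ p ] (hmap h u)) (eval A [ id , proj₁ (map f p) ] u)

    record CoordDuality : Set₁ where
      field
        coord-fp   : (V : AffVar) → IsFinPresReducedAlg (coordAlg V)
        act        : {V W : AffVar} → AffMor V W → AlgMor (coordAlg W) (coordAlg V)
        act-spec   : {V W : AffVar} (f : AffMor V W) → IsCoordMor f (act f)
        act-resp   : {V W : AffVar} (f g : AffMor V W) → f ≈Aff g → act f ≈Mor act g
        act-id     : {V : AffVar} (f : AffMor V V) → (∀ p → map f p ≈ₚ p) →
                     idMor (coordAlg V) (act f)
        act-comp   : {U V W : AffVar} (f : AffMor U V) (g : AffMor V W) (k : AffMor U W) →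
                     (∀ p → map k p ≈ₚ map g (map f p)) →
                     ∀ u → _≈_ (Str (coordAlg U)) (hmap (act k) u) (hmap (act f) (hmap (act g) u))
        full       : {V W : AffVar} (h : AlgMor (coordAlg W) (coordAlg V)) →
                     Σ[ f ∈ AffMor V W ] (act f ≈Mor h)
        faithful   : {V W : AffVar} (f g : AffMor V W) → act f ≈Mor act g → f ≈Aff g
        ess-surj   : (B : PreAlg) → IsFinPresReducedAlg B →
                     Σ[ V ∈ AffVar ] Iso B (coordAlg V)

-- A[V] is the algebra of term functions on V: it is generated by A and the coordinates x̄, and a
-- morphism V → W is the same thing as a tuple of terms t̄ mapping V into W, with A[f] the
-- substitution y_j ↦ t_j. An atomic formula α valid on V gives the quasi-algebraic sentence
-- ∀x̄ [⋀π_V(x̄) ⇒ α(x̄)] of Th_W(A|A), so α holds at every solution of π_V in every model of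
-- Th_W(A|A). Geometric closedness of A says precisely that every homomorphism A → C with C ∈ 𝒲
-- makes C such a model; hence evaluation at a solution of π_V in C is a homomorphism out of A[V],
-- i.e. A[V] is presented by (x̄, π_V ∪ D⁺A), and an algebra presented by (x̄, P ∪ D⁺A) is
-- isomorphic to A[P(A)] since both are initial for the same data.
module Submission where

open import Defs
open import Data.Nat using (ℕ)
open import Data.Fin using (Fin)
open import Data.Sum using (_⊎_; inj₁; inj₂; [_,_])
open import Data.Sum.Properties using ([,]-∘)
open import Data.Product using (Σ-syntax; _×_; _,_; proj₁; proj₂)
open import Data.List using (List; []; _∷_; _++_; tabulate)
import Data.List as List
open import Data.List.Relation.Unary.All using ([]; _∷_)
import Data.List.Relation.Unary.All as All
import Data.List.Relation.Unary.All.Properties as All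
open import Relation.Binary using (IsEquivalence)
open import Function using (id; _∘_)

module _ {L : Signature} where

  substTerm : {X Y : Set} → (X → Term L Y) → Term L X → Term L Y
  substTerm σ (var x)    = σ x
  substTerm σ (app f ts) = app f (λ i → substTerm σ (ts i))

  substAtom : {X Y : Set} → (X → Term L Y) → Atom L X → Atom L Y
  substAtom σ (t ≐ s)     = substTerm σ t ≐ substTerm σ s
  substAtom σ (relA R ts) = relA R (λ i → substTerm σ (ts i))

  module _ (M : Structure L) where
    private module M = IsEquivalence (isEquiv M)

    ∘-[,] : {X Y Z : Set} (f : Z → Carrier M) {g : X → Z} {h : Y → Z} →
            ∀ z → _≈_ M (f ([ g , h ] z)) ([ f ∘ g , f ∘ h ] z)
    ∘-[,] f z = M.reflexive ([,]-∘ f z)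

    eval-cong : {X : Set} {ρ ρ' : X → Carrier M} → (∀ x → _≈_ M (ρ x) (ρ' x)) →
                ∀ t → _≈_ M (eval M ρ t) (eval M ρ' t)
    eval-cong e (var x)    = e x
    eval-cong e (app f ts) = fun-cong M f (λ i → eval-cong e (ts i))

    eval-substTerm : {X Y : Set} (ρ : Y → Carrier M) (σ : X → Term L Y) →
                     ∀ t → _≈_ M (eval M ρ (substTerm σ t)) (eval M (eval M ρ ∘ σ) t)
    eval-substTerm ρ σ (var x)    = M.refl
    eval-substTerm ρ σ (app f ts) = fun-cong M f (λ i → eval-substTerm ρ σ (ts i))

    satAtom-cong : {X : Set} {ρ ρ' : X → Carrier M} → (∀ x → _≈_ M (ρ x) (ρ' x)) →
                   ∀ α → SatAtom M ρ α → SatAtom M ρ' α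
    satAtom-cong e (t ≐ s) h     = M.trans (M.sym (eval-cong e t)) (M.trans h (eval-cong e s))
    satAtom-cong e (relA R ts) h = rel-cong M R (λ i → eval-cong e (ts i)) h

    satAll-cong : {X : Set} {ρ ρ' : X → Carrier M} → (∀ x → _≈_ M (ρ x) (ρ' x)) →
                  ∀ Φ → SatAll M ρ Φ → SatAll M ρ' Φ
    satAll-cong e Φ = All.map (λ {α} → satAtom-cong e α)

    satQA-cong : {P : Set} {c c' : P → Carrier M} → (∀ a → _≈_ M (c a) (c' a)) →
                 ∀ σ → SatQA M c σ → SatQA M c' σ
    satQA-cong {c = c} {c'} e σ s y prem =
      satAtom-cong c≈c' (QA.concl σ) (s y (satAll-cong c'≈c (QA.prem σ) prem))
      where
        c≈c' : ∀ z → _≈_ M ([ c , y ] z) ([ c' , y ] z)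
        c≈c' = λ { (inj₁ a) → e a ; (inj₂ j) → M.refl }
        c'≈c : ∀ z → _≈_ M ([ c' , y ] z) ([ c , y ] z)
        c'≈c = λ { (inj₁ a) → M.sym (e a) ; (inj₂ j) → M.refl }

    satAtom-subst⁺ : {X Y : Set} (ρ : Y → Carrier M) (σ : X → Term L Y) →
                     ∀ α → SatAtom M (eval M ρ ∘ σ) α → SatAtom M ρ (substAtom σ α)
    satAtom-subst⁺ ρ σ (t ≐ s) h =
      M.trans (eval-substTerm ρ σ t) (M.trans h (M.sym (eval-substTerm ρ σ s)))
    satAtom-subst⁺ ρ σ (relA R ts) h = rel-cong M R (λ i → M.sym (eval-substTerm ρ σ (ts i))) h

    satAtom-subst⁻ : {X Y : Set} (ρ : Y → Carrier M) (σ : X → Term L Y) →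
                     ∀ α → SatAtom M ρ (substAtom σ α) → SatAtom M (eval M ρ ∘ σ) α
    satAtom-subst⁻ ρ σ (t ≐ s) h =
      M.trans (M.sym (eval-substTerm ρ σ t)) (M.trans h (eval-substTerm ρ σ s))
    satAtom-subst⁻ ρ σ (relA R ts) h = rel-cong M R (λ i → eval-substTerm ρ σ (ts i)) h

    satAll-subst⁺ : {X Y : Set} (ρ : Y → Carrier M) (σ : X → Term L Y) →
                    ∀ Φ → SatAll M (eval M ρ ∘ σ) Φ → SatAll M ρ (List.map (substAtom σ) Φ)
    satAll-subst⁺ ρ σ Φ = All.map⁺ ∘ All.map (λ {α} → satAtom-subst⁺ ρ σ α)

    satAll-subst⁻ : {X Y : Set} (ρ : Y → Carrier M) (σ : X → Term L Y) →
                    ∀ Φ → SatAll M ρ (List.map (substAtom σ) Φ) → SatAll M (eval M ρ ∘ σ) Φ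
    satAll-subst⁻ ρ σ Φ = All.map (λ {α} → satAtom-subst⁻ ρ σ α) ∘ All.map⁻

  module _ {B C : Structure L} {h : Carrier B → Carrier C} (hh : IsHom B C h) where
    private module B = IsEquivalence (isEquiv B)

    hom-cong : ∀ {b b'} → _≈_ B b b' → _≈_ C (h b) (h b')
    hom-cong {b} {b'} = hh (var b ≐ var b')

    hom-app : ∀ f (bs : Fin (fArity L f) → Carrier B) →
              _≈_ C (fun C f (h ∘ bs)) (h (fun B f bs))
    hom-app f bs = hh (app f (var ∘ bs) ≐ var (fun B f bs)) B.refl

    hom-satAtom : {X : Set} (ρ : X → Carrier B) → ∀ α → SatAtom B ρ α → SatAtom C (h ∘ ρ) α
    hom-satAtom ρ α s =
      satAtom-subst⁻ C h (var ∘ ρ) α (hh (substAtom (var ∘ ρ) α) (satAtom-subst⁺ B id (var ∘ ρ) α s))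

    hom-satAll : {X : Set} (ρ : X → Carrier B) → ∀ Φ → SatAll B ρ Φ → SatAll C (h ∘ ρ) Φ
    hom-satAll ρ Φ = All.map (λ {α} → hom-satAtom ρ α)

  hom-id : {B : Structure L} → IsHom B B id
  hom-id α s = s

  hom-∘ : {B C D : Structure L} {h : Carrier B → Carrier C} {k : Carrier C → Carrier D} →
          IsHom B C h → IsHom C D k → IsHom B D (k ∘ h)
  hom-∘ {h = h} hh hk α s = hom-satAtom hk h α (hh α s)

  -- The formula ⋀π(x̄) ∧ ⋀_j y_j = t_j(x̄), with variables x̄ = inj₂ ∘ inj₁ and ȳ = inj₂ ∘ inj₂.
  module _ {P : Set} {n m : ℕ} (π : List (Atom L (P ⊎ Fin n))) (t : Fin m → Term L (P ⊎ Fin n)) where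
    private
      domVars : P ⊎ Fin n → Term L (P ⊎ (Fin n ⊎ Fin m))
      domVars = [ var ∘ inj₁ , var ∘ inj₂ ∘ inj₁ ]

    graphAtoms : List (Atom L (P ⊎ (Fin n ⊎ Fin m)))
    graphAtoms = List.map (substAtom domVars) π ++
                 tabulate (λ j → var (inj₂ (inj₂ j)) ≐ substTerm domVars (t j))

    module _ (M : Structure L) (c : P → Carrier M) (x : Fin n → Carrier M) (y : Fin m → Carrier M) where
      private
        module M = IsEquivalence (isEquiv M)
        ρ : P ⊎ (Fin n ⊎ Fin m) → Carrier M
        ρ = [ c , [ x , y ] ]
        domVars-eval : ∀ z → _≈_ M (eval M ρ (domVars z)) ([ c , x ] z)
        domVars-eval = ∘-[,] M (eval M ρ)
        t-eval : ∀ j → _≈_ M (eval M ρ (substTerm domVars (t j))) (eval M [ c , x ] (t j))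
        t-eval j = M.trans (eval-substTerm M ρ domVars (t j)) (eval-cong M domVars-eval (t j))

      satGraph⁺ : SatAll M [ c , x ] π → (∀ j → _≈_ M (y j) (eval M [ c , x ] (t j))) →
                  SatAll M ρ graphAtoms
      satGraph⁺ sx ey = All.++⁺
        (satAll-subst⁺ M ρ domVars π (satAll-cong M (M.sym ∘ domVars-eval) π sx))
        (All.tabulate⁺ λ j → M.trans (ey j) (M.sym (t-eval j)))

      satGraph⁻ : SatAll M ρ graphAtoms →
                  SatAll M [ c , x ] π × (∀ j → _≈_ M (y j) (eval M [ c , x ] (t j)))
      satGraph⁻ s with All.++⁻ (List.map (substAtom domVars) π) s
      ... | sπ , sy =
        satAll-cong M domVars-eval π (satAll-subst⁻ M ρ domVars π sπ) ,
        λ j → M.trans (All.tabulate⁻ sy j) (t-eval j)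

module Coordinates {L : Signature} (Th : Theory L) (A : Structure L) where
  private module A = IsEquivalence (isEquiv A)

  Tm : AffVar Th A → Set
  Tm V = Term L (Carrier A ⊎ Fin (dim V))

  constTm : {n : ℕ} → Carrier A → Term L (Carrier A ⊎ Fin n)
  constTm a = var (inj₁ a)

  varTm : (V : AffVar Th A) → Fin (dim V) → Tm V
  varTm V i = var (inj₂ i)

  evalAt : {V : AffVar Th A} → Point Th A V → Tm V → Carrier A
  evalAt p = eval A [ id , proj₁ p ]

  eval-coords-cong : {n : ℕ} {x y : Fin n → Carrier A} → (∀ i → _≈_ A (x i) (y i)) →
                ∀ u → _≈_ A (eval A [ id , x ] u) (eval A [ id , y ] u)
  eval-coords-cong e = eval-cong A λ { (inj₁ a) → A.refl ; (inj₂ j) → e j }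

  A-modelOfThWA : ModelOfThWA Th A A id
  A-modelOfThWA σ s = s

  validOn-transfer : (M : Structure L) (c : Carrier A → Carrier M) → ModelOfThWA Th A M c →
                     (V : AffVar Th A) (α : Atom L (Carrier A ⊎ Fin (dim V))) →
                     (∀ (p : Point Th A V) → SatAtom A [ id , proj₁ p ] α) →
                     (x : Fin (dim V) → Carrier M) → SatAll M [ c , x ] (eqs V) → SatAtom M [ c , x ] α
  validOn-transfer M c model V α valid =
    model (record { nvars = dim V ; prem = eqs V ; concl = α }) (λ y sy → valid (y , sy))

  validOn-transferAll : (M : Structure L) (c : Carrier A → Carrier M) → ModelOfThWA Th A M c →
                        (V : AffVar Th A) (Φ : List (Atom L (Carrier A ⊎ Fin (dim V)))) →
                        (∀ (p : Point Th A V) → SatAll A [ id , proj₁ p ] Φ) →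
                        (x : Fin (dim V) → Carrier M) → SatAll M [ c , x ] (eqs V) → SatAll M [ c , x ] Φ
  validOn-transferAll M c model V []      valid x sx = []
  validOn-transferAll M c model V (α ∷ Φ) valid x sx =
    validOn-transfer M c model V α (All.head ∘ valid) x sx ∷
    validOn-transferAll M c model V Φ (All.tail ∘ valid) x sx

  module _ (V : AffVar Th A) where
    private
      A[V] : Structure L
      A[V] = coordStr Th A V

    evalAt-eval : {X : Set} (ρ : X → Tm V) → ∀ t (p : Point Th A V) →
                  _≈_ A (evalAt p (eval A[V] ρ t)) (eval A (evalAt p ∘ ρ) t)
    evalAt-eval ρ (var x)    p = A.refl
    evalAt-eval ρ (app f ts) p = fun-cong A f (λ i → evalAt-eval ρ (ts i) p)

    satAtom-coord⁺ : {X : Set} (ρ : X → Tm V) → ∀ α →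
                     (∀ (p : Point Th A V) → SatAtom A (evalAt p ∘ ρ) α) → SatAtom A[V] ρ α
    satAtom-coord⁺ ρ (t ≐ s) h p =
      A.trans (evalAt-eval ρ t p) (A.trans (h p) (A.sym (evalAt-eval ρ s p)))
    satAtom-coord⁺ ρ (relA R ts) h p = rel-cong A R (λ i → A.sym (evalAt-eval ρ (ts i) p)) (h p)

    satAtom-coord⁻ : {X : Set} (ρ : X → Tm V) → ∀ α →
                     SatAtom A[V] ρ α → ∀ (p : Point Th A V) → SatAtom A (evalAt p ∘ ρ) α
    satAtom-coord⁻ ρ (t ≐ s) h p =
      A.trans (A.sym (evalAt-eval ρ t p)) (A.trans (h p) (evalAt-eval ρ s p))
    satAtom-coord⁻ ρ (relA R ts) h p = rel-cong A R (λ i → evalAt-eval ρ (ts i) p) (h p)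

    satAll-coord⁻ : {X : Set} (ρ : X → Tm V) → ∀ Φ →
                    SatAll A[V] ρ Φ → ∀ (p : Point Th A V) → SatAll A (evalAt p ∘ ρ) Φ
    satAll-coord⁻ ρ Φ s p = All.map (λ {α} h → satAtom-coord⁻ ρ α h p) s

    varTm-sat : SatAll A[V] [ constTm , varTm V ] (eqs V)
    varTm-sat = All.tabulate λ {α} α∈π → satAtom-coord⁺ _ α λ p →
      satAtom-cong A (A.sym ∘ ∘-[,] A (evalAt p)) α (All.lookup (proj₂ p) α∈π)

    coordAlg-satQA : {P : Set} (c : P → Carrier A) (σ : QA P) → SatQA A c σ → SatQA A[V] (constTm ∘ c) σ
    coordAlg-satQA c σ s y prem = satAtom-coord⁺ _ (QA.concl σ) λ p →
      satAtom-cong A (A.sym ∘ ∘-[,] A (evalAt p)) (QA.concl σ)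
        (s (evalAt p ∘ y)
           (satAll-cong A (∘-[,] A (evalAt p)) (QA.prem σ) (satAll-coord⁻ _ (QA.prem σ) prem p)))

    coordAlg-modelOfThWA : ModelOfThWA Th A A[V] constTm
    coordAlg-modelOfThWA = coordAlg-satQA id

    coordAlg-inW : InW Th A → InW Th A[V]
    coordAlg-inW AW σ tσ = satQA-cong A[V] (λ ()) σ (coordAlg-satQA noParams σ (AW σ tσ))

    coordAlg-hom : IsHom A A[V] constTm
    coordAlg-hom α s = satAtom-coord⁺ constTm α (λ p → s)

    coordHom-ext : {C : Structure L} {h h' : Tm V → Carrier C} → IsHom A[V] C h → IsHom A[V] C h' →
                   (∀ z → _≈_ C (h (var z)) (h' (var z))) → ∀ u → _≈_ C (h u) (h' u)
    coordHom-ext         hh hh' e (var z)    = e z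
    coordHom-ext {C = C} hh hh' e (app f ts) =
      C.trans (C.sym (hom-app hh f ts))
        (C.trans (fun-cong C f (λ i → coordHom-ext hh hh' e (ts i))) (hom-app hh' f ts))
      where module C = IsEquivalence (isEquiv C)

    coordAlg-universal : (C : Structure L) (c : Carrier A → Carrier C) → ModelOfThWA Th A C c →
                         (x : Fin (dim V) → Carrier C) → SatAll C [ c , x ] (eqs V) →
                         IsHom A[V] C (eval C [ c , x ])
    coordAlg-universal C c model x sx α s =
      satAtom-subst⁻ C [ c , x ] id α (validOn-transfer C c model V (substAtom id α)
        (λ p → satAtom-subst⁺ A [ id , proj₁ p ] id α (satAtom-coord⁻ id α s p)) x sx)

    -- GeomClosedMap A C c and ModelOfThWA Th A C c are the same type.
    coordAlg-finPres : InW Th A → GeomClosedIn Th A → IsFinPresReducedAlg Th A (coordAlg Th A V)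
    coordAlg-finPres AW GC =
      (coordAlg-inW AW , coordAlg-hom) ,
      (dim V , eqs V , varTm V , coordAlg-inW AW , coordAlg-hom , varTm-sat ,
       λ C CW c x ch sx →
         let module C = IsEquivalence (isEquiv C)
             universal = coordAlg-universal C c (GC C CW c ch) x sx
         in eval C [ c , x ] , universal , (λ a → C.refl) , (λ i → C.refl) ,
            λ h' hh' h'c h'x → coordHom-ext universal hh'
              λ { (inj₁ a) → C.sym (h'c a) ; (inj₂ i) → C.sym (h'x i) })

  module _ {V W : AffVar Th A} where

    MapsInto : (Fin (dim W) → Tm V) → Set
    MapsInto t = (p : Point Th A V) → SatAll A [ id , evalAt p ∘ t ] (eqs W)

    substitute : (Fin (dim W) → Tm V) → Tm W → Tm V
    substitute t = eval (coordStr Th A V) [ constTm , t ]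

    evalAt-substitute : (t : Fin (dim W) → Tm V) → ∀ u p →
                        _≈_ A (evalAt p (substitute t u)) (eval A [ id , evalAt p ∘ t ] u)
    evalAt-substitute t u p =
      A.trans (evalAt-eval V [ constTm , t ] u p) (eval-cong A (∘-[,] A (evalAt p)) u)

    mapsInto-model : (t : Fin (dim W) → Tm V) → MapsInto t →
                     (M : Structure L) (c : Carrier A → Carrier M) → ModelOfThWA Th A M c →
                     (x : Fin (dim V) → Carrier M) → SatAll M [ c , x ] (eqs V) →
                     SatAll M [ c , eval M [ c , x ] ∘ t ] (eqs W)
    mapsInto-model t into M c model x sx =
      satAll-cong M (∘-[,] M (eval M [ c , x ])) (eqs W)
        (satAll-subst⁻ M [ c , x ] [ constTm , t ] (eqs W)
          (validOn-transferAll M c model V (List.map (substAtom [ constTm , t ]) (eqs W))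
            (λ p → satAll-subst⁺ A [ id , proj₁ p ] [ constTm , t ] (eqs W)
              (satAll-cong A (A.sym ∘ ∘-[,] A (evalAt p)) (eqs W) (into p)))
            x sx))

    module _ (t : Fin (dim W) → Tm V) (into : MapsInto t) where

      pointMap : Point Th A V → Point Th A W
      pointMap p = evalAt p ∘ t , into p

      substituteMor : AlgMor Th A (coordAlg Th A W) (coordAlg Th A V)
      substituteMor = record
        { hmap = substitute t
        ; hom  = λ α s → satAtom-coord⁺ V (substitute t) α λ p →
                   satAtom-cong A (λ u → A.sym (evalAt-substitute t u p)) α
                     (satAtom-coord⁻ W id α s (pointMap p))
        ; comm = λ a p → A.refl
        }

      termAffMor : AffMor Th A V W
      termAffMor = record
        { map    = pointMap
        ; φ      = graphAtoms (eqs V) t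
        ; func   = λ M c _ x y y' s s' j → let module M = IsEquivalence (isEquiv M) in
                     M.trans (proj₂ (graph M c x y s) j) (M.sym (proj₂ (graph M c x y' s') j))
        ; dom→   = λ M c _ x sx → eval M [ c , x ] ∘ t ,
                     satGraph⁺ (eqs V) t M c x _ sx (λ j → IsEquivalence.refl (isEquiv M))
        ; dom←   = λ M c _ x (y , s) → proj₁ (graph M c x y s)
        ; cod    = λ M c model x y s → let module M = IsEquivalence (isEquiv M) in
                     satAll-cong M (λ { (inj₁ a) → M.refl ; (inj₂ j) → M.sym (proj₂ (graph M c x y s) j) })
                       (eqs W)
                       (mapsInto-model t into M c model x (proj₁ (graph M c x y s)))
        ; graph→ = λ b c e → satGraph⁺ (eqs V) t A id (proj₁ b) (proj₁ c) (proj₂ b) (A.sym ∘ e)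
        ; graph← = λ b c s → A.sym ∘ proj₂ (graph A id (proj₁ b) (proj₁ c) s)
        }
        where graph = satGraph⁻ (eqs V) t

    module _ (f : AffMor Th A V W) where
      private
        generic : Σ[ y ∈ (Fin (dim W) → Tm V) ] SatAll (coordStr Th A V) [ constTm , [ varTm V , y ] ] (φ f)
        generic = dom→ f (coordStr Th A V) constTm (coordAlg-modelOfThWA V) (varTm V) (varTm-sat V)

      morTerms : Fin (dim W) → Tm V
      morTerms = proj₁ generic

      morTerms-graph : ∀ (p : Point Th A V) → SatAll A [ id , [ proj₁ p , evalAt p ∘ morTerms ] ] (φ f)
      morTerms-graph p =
        satAll-cong A (λ { (inj₁ a) → A.refl ; (inj₂ (inj₁ i)) → A.refl ; (inj₂ (inj₂ j)) → A.refl }) (φ f) (satAll-coord⁻ V _ (φ f) (proj₂ generic) p)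

      morTerms-into : MapsInto morTerms
      morTerms-into p = cod f A id A-modelOfThWA (proj₁ p) _ (morTerms-graph p)

      morTerms-spec : ∀ p → _≈ₚ_ Th A {W} (map f p) (pointMap morTerms morTerms-into p)
      morTerms-spec p = graph← f p (pointMap morTerms morTerms-into p) (morTerms-graph p)

      coordMor : AlgMor Th A (coordAlg Th A W) (coordAlg Th A V)
      coordMor = substituteMor morTerms morTerms-into

      coordMor-spec : IsCoordMor Th A f coordMor
      coordMor-spec u p =
        A.trans (evalAt-substitute morTerms u p) (A.sym (eval-coords-cong (morTerms-spec p) u))

  coordMor-cong : {V W : AffVar Th A} (f g : AffMor Th A V W) → _≈Aff_ Th A f g →
                  _≈Mor_ Th A (coordMor f) (coordMor g)
  coordMor-cong f g e u p =
    A.trans (coordMor-spec f u p) (A.trans (eval-coords-cong (e p) u) (A.sym (coordMor-spec g u p)))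

  coordMor-identity : {V : AffVar Th A} (f : AffMor Th A V V) → (∀ p → _≈ₚ_ Th A {V} (map f p) p) →
                      idMor Th A (coordAlg Th A V) (coordMor f)
  coordMor-identity f e u p = A.trans (coordMor-spec f u p) (eval-coords-cong (e p) u)

  coordMor-homomorphism : {U V W : AffVar Th A}
                          (f : AffMor Th A U V) (g : AffMor Th A V W) (k : AffMor Th A U W) →
                          (∀ p → _≈ₚ_ Th A {W} (map k p) (map g (map f p))) → ∀ u →
                          _≈_ (coordStr Th A U) (hmap (coordMor k) u) (hmap (coordMor f) (hmap (coordMor g) u))
  coordMor-homomorphism f g k e u p =
    A.trans (coordMor-spec k u p) (A.trans (eval-coords-cong (e p) u)
      (A.sym (A.trans (coordMor-spec f (hmap (coordMor g) u) p) (coordMor-spec g u (map f p)))))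

  coordMor-faithful : {V W : AffVar Th A} (f g : AffMor Th A V W) →
                      _≈Mor_ Th A (coordMor f) (coordMor g) → _≈Aff_ Th A f g
  coordMor-faithful {W = W} f g e p j =
    A.trans (A.sym (coordMor-spec f (varTm W j) p))
      (A.trans (e (varTm W j) p) (coordMor-spec g (varTm W j) p))

  algMor-mapsInto : {V W : AffVar Th A} (h : AlgMor Th A (coordAlg Th A W) (coordAlg Th A V)) →
                    MapsInto (hmap h ∘ varTm W)
  algMor-mapsInto {V} {W} h p =
    satAll-cong A (λ { (inj₁ a) → comm h a p ; (inj₂ j) → A.refl }) (eqs W)
      (satAll-coord⁻ V _ (eqs W) (hom-satAll (hom h) [ constTm , varTm W ] (eqs W) (varTm-sat W)) p)

  coordMor-full : {V W : AffVar Th A} (h : AlgMor Th A (coordAlg Th A W) (coordAlg Th A V)) →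
                  Σ[ f ∈ AffMor Th A V W ] _≈Mor_ Th A (coordMor f) h
  coordMor-full {V} {W} h = f , coordHom-ext W (hom (coordMor f)) (hom h)
    λ { (inj₁ a) p → A.sym (comm h a p) ; (inj₂ j) p → coordMor-spec f (varTm W j) p }
    where f = termAffMor (hmap h ∘ varTm W) (algMor-mapsInto h)

  finPres-iso-coordAlg : InW Th A → GeomClosedIn Th A → (B : PreAlg Th A) → IsFinPresReducedAlg Th A B →
                         Σ[ V ∈ AffVar Th A ] Iso Th A B (coordAlg Th A V)
  finPres-iso-coordAlg AW GC B (_ , k , P , g , BW , Bhom , Bsat , initial) =
    V , record { hmap = to ; hom = to-hom ; comm = to-const } ,
        record { hmap = from ; hom = from-hom ; comm = λ a → B.refl } ,
        from∘to , coordHom-ext V (hom-∘ from-hom to-hom) hom-id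
                    (λ { (inj₁ a) → to-const a ; (inj₂ i) → to-gen i })
    where
      module B = IsEquivalence (isEquiv (Str B))
      V : AffVar Th A
      V = record { dim = k ; eqs = P }
      initial-V =
        initial (coordStr Th A V) (coordAlg-inW V AW) constTm (varTm V) (coordAlg-hom V) (varTm-sat V)
      to = proj₁ initial-V
      to-hom = proj₁ (proj₂ initial-V)
      to-const = proj₁ (proj₂ (proj₂ initial-V))
      to-gen = proj₁ (proj₂ (proj₂ (proj₂ initial-V)))
      from : Tm V → Carrier (Str B)
      from = eval (Str B) [ str B , g ]
      from-hom : IsHom (coordStr Th A V) (Str B) from
      from-hom = coordAlg-universal V (Str B) (str B) (GC (Str B) BW (str B) Bhom) g Bsat
      B-unique = proj₂ (proj₂ (proj₂ (proj₂ (initial (Str B) BW (str B) g Bhom Bsat))))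
      from∘to : ∀ b → _≈_ (Str B) (from (to b)) b
      from∘to b = B.trans
        (B.sym (B-unique (from ∘ to) (hom-∘ to-hom from-hom)
                 (λ a → hom-cong from-hom {to (str B a)} {constTm a} (to-const a))
                 (λ i → hom-cong from-hom {to (g i)} {varTm V i} (to-gen i)) b))
        (B-unique id hom-id (λ a → B.refl) (λ i → B.refl) b)

theorem3p15 : {L : Signature} (T : Theory L) (A : Structure L) →
              InW T A → GeomClosedIn T A → CoordDuality T A
theorem3p15 T A AW GC = record
  { coord-fp  = λ V → coordAlg-finPres V AW GC
  ; act       = coordMor
  ; act-spec  = coordMor-spec
  ; act-resp  = coordMor-cong
  ; act-id    = coordMor-identity
  ; act-comp  = coordMor-homomorphism
  ; full      = coordMor-full
  ; faithful  = coordMor-faithful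
  ; ess-surj  = finPres-iso-coordAlg AW GC
  }
  where open Coordinates T A
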